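{- Let $\mathbb{F}$ be a finite field of characteristic $2$, let $P\in\mathbb{F}[x_1,\dots,x_m]$ be multilinear, and let $L$ be a polynomial of total degree at most $1$ with zero constant coefficient, whose coefficient $\alpha_i$ of $x_i$ is nonzero. If there is a multilinear $Q$ with $P=\mathrm{Mult}_0(L\cdot Q)$, then $P=\mathrm{Mult}_0\!\left(L\cdot\frac{1}{\alpha_i}\frac{\partial P}{\partial x_i}\right)$.
   Context: A polynomial is multilinear if each monomial has degree at most $1$ in each variable. $\mathrm{Mult}_0(R)$ is the reduction of $R$ modulo $\langle x_1^2,\dots,x_m^2\rangle$, i.e. $R$ with every monomial divisible by some $x_j^2$ deleted. -}

module Defs where

open import Level using (_⊔_)
open import Algebra.Bundles using (CommutativeRing)
open import Data.Nat using (ℕ; zero; suc; _≤_; _≤?_; _<_; _∸_)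
open import Data.Fin using (Fin)
open import Data.Vec using (Vec; []; _∷_; lookup; replicate; _[_]≔_; sum)
open import Data.Vec.Relation.Unary.All using (All; all?)
open import Data.List using (List; []; _∷_; map; concatMap; upTo; foldr)
open import Data.Product using (_×_; _,_; Σ; ∃)
open import Relation.Nullary using (¬_; yes; no)

-- Polynomials / formal power series over a commutative ring R in m variables,
-- given by their coefficient function on exponent vectors (monomials).
module PolyDefs {c ℓ} (R : CommutativeRing c ℓ) where
  open CommutativeRing R

  Mon : ℕ → Set
  Mon m = Vec ℕ m

  Poly : ℕ → Set c
  Poly m = Mon m → Carrier

  zeroMon : (m : ℕ) → Mon m
  zeroMon m = replicate m 0

  unitMon : {m : ℕ} → Fin m → Mon m
  unitMon {m} i = replicate m 0 [ i ]≔ 1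

  totalDeg : {m : ℕ} → Mon m → ℕ
  totalDeg e = sum e

  splits : {m : ℕ} → Mon m → List (Mon m × Mon m)
  splits [] = ([] , []) ∷ []
  splits (k ∷ e) =
    concatMap (λ j → map (λ { (d , r) → (j ∷ d , (k ∸ j) ∷ r) }) (splits e)) (upTo (suc k))

  ΣL : List Carrier → Carrier
  ΣL = foldr _+_ 0#

  _*P_ : {m : ℕ} → Poly m → Poly m → Poly m
  (A *P B) e = ΣL (map (λ { (d , r) → A d * B r }) (splits e))

  _·P_ : {m : ℕ} → Carrier → Poly m → Poly m
  (a ·P A) e = a * A e

  natMul : ℕ → Carrier → Carrier
  natMul zero x = 0#
  natMul (suc n) x = x + natMul n x

  ∂ : {m : ℕ} → Fin m → Poly m → Poly m
  ∂ i A e = natMul (suc (lookup e i)) (A (e [ i ]≔ suc (lookup e i)))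

  MultilinearMon : {m : ℕ} → Mon m → Set
  MultilinearMon e = All (_≤ 1) e

  Multilinear : {m : ℕ} → Poly m → Set ℓ
  Multilinear A = ∀ e → ¬ MultilinearMon e → A e ≈ 0#

  TotalDeg≤1 : {m : ℕ} → Poly m → Set ℓ
  TotalDeg≤1 A = ∀ e → 1 < totalDeg e → A e ≈ 0#

  -- Mult_0: reduction modulo ⟨x_1^2,…,x_m^2⟩
  Mult₀ : {m : ℕ} → Poly m → Poly m
  Mult₀ A e with all? (_≤? 1) e
  ... | yes _ = A e
  ... | no _ = 0#

  _≈P_ : {m : ℕ} → Poly m → Poly m → Set ℓ
  A ≈P B = ∀ e → A e ≈ B e

record IsFiniteField {c ℓ} (R : CommutativeRing c ℓ) : Set (c ⊔ ℓ) where
  open CommutativeRing R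
  field
    nontrivial : ¬ (0# ≈ 1#)
    inverse    : ∀ x → ¬ (x ≈ 0#) → Σ Carrier (λ y → x * y ≈ 1#)
    finite     : Σ ℕ (λ n → Σ (Fin n → Carrier) (λ enum → ∀ x → ∃ (λ k → enum k ≈ x)))

Char2 : ∀ {c ℓ} (R : CommutativeRing c ℓ) → Set ℓ
Char2 R = 1# + 1# ≈ 0#
  where open CommutativeRing R

-- Write L = Σ_j α_j x_j and α⁻¹ for the inverse of α_i. On a multilinear monomial x^e the
-- coefficient of L·A is Σ_j [e_j = 1] α_j · A(e − δ_j). If e_i = 1, only j = i survives in
-- L·α⁻¹∂_iP, since ∂_iP vanishes on monomials containing x_i in characteristic 2; that term
-- is P(e). If e_i = 0, the Leibniz rule ∂_i(L·Q) = α_i Q + L·∂_iQ gives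
-- α⁻¹∂_iP = Q + α⁻¹ L·∂_iQ on the relevant monomials, so the coefficient becomes
-- (L·Q)(e) + α⁻¹ (L·L·∂_iQ)(e). The second term vanishes: the coefficient of L·L·B at a
-- multilinear monomial is a sum over pairs (j, k) that is symmetric and has zero diagonal,
-- hence zero in characteristic 2.
module Submission where

open import Defs
open import Algebra.Bundles using (CommutativeMonoid; CommutativeRing)
open import Data.Empty using (⊥-elim)
open import Data.Fin using (Fin; zero; suc; punchIn)
open import Data.Fin.Properties using (_≟_; punchInᵢ≢i)
open import Data.List using (List; []; _∷_; _++_; map; concatMap; upTo; applyUpTo)
open import Data.List.Properties using (map-++; map-∘; map-cong)
import Data.List.Relation.Unary.All as ListAll
open import Data.List.Relation.Unary.All.Properties using (applyUpTo⁺₂)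
open import Data.Nat using (ℕ; zero; suc; _≤_; _<_; z≤n; s≤s; _≤?_; _∸_)
open import Data.Nat.Properties
  using (suc-injective; m+n≡0⇒m≡0; m+n≡0⇒n≡0; n≤1⇒n≡0∨n≡1; ≤-trans; n≤1+n; 0≢1+n)
open import Data.Product using (_,_; Σ; _×_)
open import Data.Sum using (inj₁; inj₂)
open import Data.Vec using (Vec; []; _∷_; lookup; _[_]≔_)
open import Data.Vec.Properties
  using ([]≔-idempotent; []≔-lookup; []≔-commutes; lookup∘update; lookup∘update′)
open import Data.Vec.Relation.Unary.All using (All; []; _∷_; all?)
open import Data.Vec.Relation.Unary.All.Properties using (lookup⁺)
open import Function using (_∘_)
open import Relation.Binary.PropositionalEquality as ≡ using (_≡_; _≢_)
open import Relation.Nullary using (¬_; yes; no)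

[]≔-restore : ∀ {A : Set} {n} (v : Vec A n) i {a b} → lookup v i ≡ a → (v [ i ]≔ b) [ i ]≔ a ≡ v
[]≔-restore v i ≡.refl = ≡.trans ([]≔-idempotent v i) ([]≔-lookup v i)

All≤1-update : ∀ {n} {e : Vec ℕ n} → All (_≤ 1) e → ∀ j {a} → a ≤ 1 → All (_≤ 1) (e [ j ]≔ a)
All≤1-update (_ ∷ e≤1) zero    a≤1 = a≤1 ∷ e≤1
All≤1-update (p ∷ e≤1) (suc j) a≤1 = p ∷ All≤1-update e≤1 j a≤1

module FiniteSums {a ℓ} (M : CommutativeMonoid a ℓ) where
  open CommutativeMonoid M
  open import Algebra.Properties.CommutativeMonoid.Sum M
  open import Data.Vec.Functional using (removeAt)
  open import Relation.Binary.Reasoning.Setoid setoid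

  sum-extract : ∀ {n} (f g : Fin n → Carrier) i → g i ≈ ε → (∀ j → j ≢ i → f j ≈ g j) →
                sum f ≈ f i ∙ sum g
  sum-extract {suc n} f g i gᵢ≈ε f≈g = begin
    sum f                          ≈⟨ sum-remove {i = i} f ⟩
    f i ∙ sum (removeAt f i)       ≈⟨ ∙-congˡ (sum-cong-≋ (λ k → f≈g (punchIn i k) (punchInᵢ≢i i k))) ⟩
    f i ∙ sum (removeAt g i)       ≈⟨ ∙-congˡ (identityˡ _) ⟨
    f i ∙ (ε ∙ sum (removeAt g i)) ≈⟨ ∙-congˡ (∙-congʳ gᵢ≈ε) ⟨
    f i ∙ (g i ∙ sum (removeAt g i)) ≈⟨ ∙-congˡ (sum-remove {i = i} g) ⟨
    f i ∙ sum g                    ∎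

  sum-single : ∀ {n} (f : Fin n → Carrier) i → (∀ j → j ≢ i → f j ≈ ε) → sum f ≈ f i
  sum-single {n} f i f≈ε = begin
    sum f                     ≈⟨ sum-extract f (λ _ → ε) i refl f≈ε ⟩
    f i ∙ sum {n} (λ _ → ε)   ≈⟨ ∙-congˡ (sum-replicate-zero n) ⟩
    f i ∙ ε                   ≈⟨ identityʳ (f i) ⟩
    f i                       ∎

  ∑∑-symmetric≈ε : (∀ x → x ∙ x ≈ ε) → ∀ {n} (G : Fin n → Fin n → Carrier) →
                   (∀ j k → G j k ≈ G k j) → (∀ j → G j j ≈ ε) →
                   ∑[ j < n ] ∑[ k < n ] G j k ≈ ε
  ∑∑-symmetric≈ε x∙x≈ε {zero}  G G-sym G-diag = refl
  ∑∑-symmetric≈ε x∙x≈ε {suc n} G G-sym G-diag = begin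
    (G zero zero ∙ row) ∙ ∑[ j < n ] (G (suc j) zero ∙ ∑[ k < n ] G (suc j) (suc k))
      ≈⟨ ∙-cong (∙-congʳ (G-diag zero)) (∑-distrib-+ (λ j → G (suc j) zero) _) ⟩
    (ε ∙ row) ∙ (∑[ j < n ] G (suc j) zero ∙ ∑[ j < n ] ∑[ k < n ] G (suc j) (suc k))
      ≈⟨ ∙-cong (identityˡ row) (∙-cong column≈row inner≈ε) ⟩
    row ∙ (row ∙ ε) ≈⟨ ∙-congˡ (identityʳ row) ⟩
    row ∙ row       ≈⟨ x∙x≈ε row ⟩
    ε               ∎
    where
    row : Carrier
    row = ∑[ k < n ] G zero (suc k)
    column≈row : ∑[ j < n ] G (suc j) zero ≈ row
    column≈row = sum-cong-≋ (λ j → G-sym (suc j) zero)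
    inner≈ε : ∑[ j < n ] ∑[ k < n ] G (suc j) (suc k) ≈ ε
    inner≈ε = ∑∑-symmetric≈ε x∙x≈ε (λ j k → G (suc j) (suc k)) (λ j k → G-sym (suc j) (suc k)) (G-diag ∘ suc)

module Coefficients {c ℓ} (F : CommutativeRing c ℓ) where
  open CommutativeRing F hiding (zero)
  open PolyDefs F
  open import Algebra.Properties.Semiring.Sum semiring
  open import Algebra.Properties.CommutativeSemigroup +-commutativeSemigroup using (interchange)
  open import Algebra.Properties.CommutativeSemigroup *-commutativeSemigroup using (x∙yz≈y∙xz)
  open FiniteSums +-commutativeMonoid
  open import Relation.Binary.Reasoning.Setoid setoid

  x+x≈0 : Char2 F → ∀ x → x + x ≈ 0#
  x+x≈0 char2 x = begin
    x + x             ≈⟨ +-cong (*-identityˡ x) (*-identityˡ x) ⟨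
    1# * x + 1# * x   ≈⟨ distribʳ x 1# 1# ⟨
    (1# + 1#) * x     ≈⟨ *-congʳ char2 ⟩
    0# * x            ≈⟨ zeroˡ x ⟩
    0#                ∎

  ΣL-++ : ∀ xs ys → ΣL (xs ++ ys) ≈ ΣL xs + ΣL ys
  ΣL-++ []       ys = sym (+-identityˡ _)
  ΣL-++ (x ∷ xs) ys = trans (+-congˡ (ΣL-++ xs ys)) (sym (+-assoc _ _ _))

  ΣL-concatMap : ∀ {A B : Set} (g : B → Carrier) (f : A → List B) xs →
                 ΣL (map g (concatMap f xs)) ≈ ΣL (map (λ x → ΣL (map g (f x))) xs)
  ΣL-concatMap g f []       = refl
  ΣL-concatMap g f (x ∷ xs) = begin
    ΣL (map g (f x ++ concatMap f xs))              ≡⟨ ≡.cong ΣL (map-++ g (f x) (concatMap f xs)) ⟩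
    ΣL (map g (f x) ++ map g (concatMap f xs))      ≈⟨ ΣL-++ (map g (f x)) _ ⟩
    ΣL (map g (f x)) + ΣL (map g (concatMap f xs))  ≈⟨ +-congˡ (ΣL-concatMap g f xs) ⟩
    _                                               ∎

  ΣL-map-cong : ∀ {A : Set} {f g : A → Carrier} → (∀ x → f x ≈ g x) → ∀ xs → ΣL (map f xs) ≈ ΣL (map g xs)
  ΣL-map-cong f≈g []       = refl
  ΣL-map-cong f≈g (x ∷ xs) = +-cong (f≈g x) (ΣL-map-cong f≈g xs)

  ΣL-map-≈0 : ∀ {A : Set} (f : A → Carrier) xs → ListAll.All (λ x → f x ≈ 0#) xs → ΣL (map f xs) ≈ 0#
  ΣL-map-≈0 f []       ListAll.[]           = refl
  ΣL-map-≈0 f (x ∷ xs) (fx≈0 ListAll.∷ f≈0) = trans (+-cong fx≈0 (ΣL-map-≈0 f xs f≈0)) (+-identityˡ 0#)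

  ΣL-map-+ : ∀ {A : Set} (f g : A → Carrier) xs →
             ΣL (map (λ x → f x + g x) xs) ≈ ΣL (map f xs) + ΣL (map g xs)
  ΣL-map-+ f g []       = sym (+-identityˡ 0#)
  ΣL-map-+ f g (x ∷ xs) = trans (+-congˡ (ΣL-map-+ f g xs)) (interchange _ _ _ _)

  ΣL-map-* : ∀ {A : Set} a (f : A → Carrier) xs → ΣL (map (λ x → a * f x) xs) ≈ a * ΣL (map f xs)
  ΣL-map-* a f []       = sym (zeroʳ a)
  ΣL-map-* a f (x ∷ xs) = trans (+-congˡ (ΣL-map-* a f xs)) (sym (distribˡ a _ _))

  totalDeg≡0⇒zeroMon : ∀ {m} (d : Mon m) → totalDeg d ≡ 0 → d ≡ zeroMon m
  totalDeg≡0⇒zeroMon []      _  = ≡.refl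
  totalDeg≡0⇒zeroMon (k ∷ d) eq = ≡.cong₂ _∷_ (m+n≡0⇒m≡0 k eq) (totalDeg≡0⇒zeroMon d (m+n≡0⇒n≡0 k eq))

  Mult₀-multilinear : ∀ {m} (A : Poly m) e → MultilinearMon e → Mult₀ A e ≈ A e
  Mult₀-multilinear A e e-ml with all? (_≤? 1) e
  ... | yes _    = refl
  ... | no ¬e-ml = ⊥-elim (¬e-ml e-ml)

  infixl 6 _+P_
  _+P_ : ∀ {m} → Poly m → Poly m → Poly m
  (A +P B) e = A e + B e

  *P-distribˡ-+P : ∀ {m} (L A B : Poly m) e → (L *P (A +P B)) e ≈ (L *P A) e + (L *P B) e
  *P-distribˡ-+P L A B e =
    trans (ΣL-map-cong (λ (d , r) → distribˡ (L d) (A r) (B r)) (splits e)) (ΣL-map-+ _ _ (splits e))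

  *P-·P : ∀ {m} (L A : Poly m) a e → (L *P (a ·P A)) e ≈ a * (L *P A) e
  *P-·P L A a e =
    trans (ΣL-map-cong (λ (d , r) → x∙yz≈y∙xz (L d) a (A r)) (splits e)) (ΣL-map-* a _ (splits e))

  *P-∷ : ∀ {m} (L A : Poly (suc m)) k e →
         (L *P A) (k ∷ e) ≈ ΣL (map (λ j → ((L ∘ (j ∷_)) *P (A ∘ ((k ∸ j) ∷_))) e) (upTo (suc k)))
  *P-∷ L A k e = trans (ΣL-concatMap (λ (d , r) → L d * A r)
                                     (λ j → map (λ (d , r) → (j ∷ d , (k ∸ j) ∷ r)) (splits e)) (upTo (suc k)))
    (reflexive (≡.cong ΣL (map-cong (λ j → ≡.cong ΣL (≡.sym (map-∘ (splits e)))) (upTo (suc k)))))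

  *P-zeroˡ : ∀ {m} (L A : Poly m) e → (∀ d → L d ≈ 0#) → (L *P A) e ≈ 0#
  *P-zeroˡ L A e L≈0 = ΣL-map-≈0 _ (splits e)
    (ListAll.universal (λ (d , r) → trans (*-congʳ (L≈0 d)) (zeroˡ (A r))) (splits e))

  constant-*P : ∀ {m} (L A : Poly m) → (∀ d → totalDeg d ≢ 0 → L d ≈ 0#) →
                ∀ e → (L *P A) e ≈ L (zeroMon m) * A e
  constant-*P L A L≈0 []      = +-identityʳ _
  constant-*P L A L≈0 (k ∷ e) = begin
    (L *P A) (k ∷ e)                          ≈⟨ *P-∷ L A k e ⟩
    term 0 + ΣL (map term (applyUpTo suc k))  ≈⟨ +-cong (constant-*P (L ∘ (0 ∷_)) (A ∘ (k ∷_)) (L≈0 ∘ (0 ∷_)) e)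
                                                         (ΣL-map-≈0 term _ (applyUpTo⁺₂ suc k higher≈0)) ⟩
    L (zeroMon _) * A (k ∷ e) + 0#            ≈⟨ +-identityʳ _ ⟩
    L (zeroMon _) * A (k ∷ e)                 ∎
    where
    term : ℕ → Carrier
    term j = ((L ∘ (j ∷_)) *P (A ∘ ((k ∸ j) ∷_))) e
    higher≈0 : ∀ t → term (suc t) ≈ 0#
    higher≈0 t = *P-zeroˡ _ _ e (λ d → L≈0 (suc t ∷ d) (λ ()))

  LinearForm : ∀ {m} → Poly m → Set ℓ
  LinearForm L = ∀ d → totalDeg d ≢ 1 → L d ≈ 0#

  totalDeg≤1⇒LinearForm : ∀ {m} {L : Poly m} → TotalDeg≤1 L → L (zeroMon m) ≈ 0# → LinearForm L
  totalDeg≤1⇒LinearForm {L = L} deg≤1 L₀≈0 d d≢1 with totalDeg d in eq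
  ... | zero        = trans (reflexive (≡.cong L (totalDeg≡0⇒zeroMon d eq))) L₀≈0
  ... | suc zero    = ⊥-elim (d≢1 ≡.refl)
  ... | suc (suc _) = deg≤1 d (≡.subst (1 <_) (≡.sym eq) (s≤s (s≤s z≤n)))

  atPred : ℕ → (ℕ → Carrier) → Carrier
  atPred zero    f = 0#
  atPred (suc t) f = f t

  -- The coefficient of x^e in x_j · A.
  varMul : ∀ {m} → Fin m → Poly m → Poly m
  varMul j A e = atPred (lookup e j) (λ t → A (e [ j ]≔ t))

  atPred-cong : ∀ n {f g : ℕ → Carrier} → (∀ t → n ≡ suc t → f t ≈ g t) → atPred n f ≈ atPred n g
  atPred-cong zero    f≈g = refl
  atPred-cong (suc t) f≈g = f≈g t ≡.refl

  atPred-≈0 : ∀ n {f : ℕ → Carrier} → (∀ t → n ≡ suc t → f t ≈ 0#) → atPred n f ≈ 0#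
  atPred-≈0 zero    f≈0 = refl
  atPred-≈0 (suc t) f≈0 = f≈0 t ≡.refl

  atPred-* : ∀ n a (f : ℕ → Carrier) → atPred n (λ t → a * f t) ≈ a * atPred n f
  atPred-* zero    a f = sym (zeroʳ a)
  atPred-* (suc t) a f = refl

  atPred-∑ : ∀ {m} n (h : ℕ → Fin m → Carrier) →
             atPred n (λ t → ∑[ k < m ] h t k) ≈ ∑[ k < m ] atPred n (λ t → h t k)
  atPred-∑ {m} zero    h = sym (sum-replicate-zero m)
  atPred-∑     (suc t) h = refl

  atPred-swap : ∀ a b (h : ℕ → ℕ → Carrier) →
                atPred a (λ t → atPred b (h t)) ≡ atPred b (λ s → atPred a (λ t → h t s))
  atPred-swap zero    zero    h = ≡.refl
  atPred-swap zero    (suc s) h = ≡.refl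
  atPred-swap (suc t) zero    h = ≡.refl
  atPred-swap (suc t) (suc s) h = ≡.refl

  varMul-at-zero : ∀ {m} j (A : Poly m) e → lookup e j ≡ 0 → varMul j A e ≡ 0#
  varMul-at-zero j A e eq rewrite eq = ≡.refl

  varMul-at-suc : ∀ {m} j (A : Poly m) e {t} → lookup e j ≡ suc t → varMul j A e ≡ A (e [ j ]≔ t)
  varMul-at-suc j A e eq rewrite eq = ≡.refl

  varMul-update′ : ∀ {m} {j k : Fin m} → j ≢ k → ∀ (A : Poly m) e t →
                   varMul k A (e [ j ]≔ t) ≡ atPred (lookup e k) (λ s → A ((e [ j ]≔ t) [ k ]≔ s))
  varMul-update′ {k = k} j≢k A e t =
    ≡.cong (λ n → atPred n (λ s → A ((e [ _ ]≔ t) [ k ]≔ s))) (lookup∘update′ (j≢k ∘ ≡.sym) e t)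

  varMul-comm : ∀ {m} (j k : Fin m) (B : Poly m) e → varMul j (varMul k B) e ≈ varMul k (varMul j B) e
  varMul-comm j k B e with j ≟ k
  ... | yes ≡.refl = refl
  ... | no j≢k     = begin
    varMul j (varMul k B) e
      ≈⟨ atPred-cong (lookup e j) (λ t _ → reflexive (varMul-update′ j≢k B e t)) ⟩
    atPred (lookup e j) (λ t → atPred (lookup e k) (λ s → B ((e [ j ]≔ t) [ k ]≔ s)))
      ≡⟨ atPred-swap (lookup e j) (lookup e k) _ ⟩
    atPred (lookup e k) (λ s → atPred (lookup e j) (λ t → B ((e [ j ]≔ t) [ k ]≔ s)))
      ≈⟨ atPred-cong (lookup e k) (λ s _ → atPred-cong (lookup e j) (λ t _ →
           reflexive (≡.cong B ([]≔-commutes e j k j≢k)))) ⟩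
    atPred (lookup e k) (λ s → atPred (lookup e j) (λ t → B ((e [ k ]≔ s) [ j ]≔ t)))
      ≈⟨ atPred-cong (lookup e k) (λ s _ → reflexive (varMul-update′ (j≢k ∘ ≡.sym) B e s)) ⟨
    varMul k (varMul j B) e
      ∎

  varMul²≈0 : ∀ {m} j (B : Poly m) e → lookup e j ≤ 1 → varMul j (varMul j B) e ≈ 0#
  varMul²≈0 j B e eⱼ≤1 with n≤1⇒n≡0∨n≡1 eⱼ≤1
  ... | inj₁ eⱼ≡0 = reflexive (varMul-at-zero j (varMul j B) e eⱼ≡0)
  ... | inj₂ eⱼ≡1 =
    reflexive (≡.trans (varMul-at-suc j (varMul j B) e eⱼ≡1)
                       (varMul-at-zero j B (e [ j ]≔ 0) (lookup∘update j e 0)))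

  -- The summands of *P-∷ in which the left factor has positive exponent of x₀.
  linearForm-*P-head : ∀ {m} {L : Poly (suc m)} → LinearForm L → ∀ A k e →
    ΣL (map (λ j → ((L ∘ (j ∷_)) *P (A ∘ ((k ∸ j) ∷_))) e) (applyUpTo suc k))
      ≈ L (unitMon zero) * varMul zero A (k ∷ e)
  linearForm-*P-head         L-lin A zero    e = sym (zeroʳ _)
  linearForm-*P-head {L = L} L-lin A (suc k) e = begin
    term 1 + ΣL (map term (applyUpTo (λ t → suc (suc t)) k))
      ≈⟨ +-cong (constant-*P (L ∘ (1 ∷_)) (A ∘ (k ∷_)) (λ d d≢0 → L-lin (1 ∷ d) (d≢0 ∘ suc-injective)) e)
                (ΣL-map-≈0 term _ (applyUpTo⁺₂ (λ t → suc (suc t)) k higher≈0)) ⟩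
    L (unitMon zero) * A (k ∷ e) + 0# ≈⟨ +-identityʳ _ ⟩
    L (unitMon zero) * A (k ∷ e)      ∎
    where
    term : ℕ → Carrier
    term j = ((L ∘ (j ∷_)) *P (A ∘ ((suc k ∸ j) ∷_))) e
    higher≈0 : ∀ t → term (suc (suc t)) ≈ 0#
    higher≈0 t = *P-zeroˡ _ _ e (λ d → L-lin (suc (suc t) ∷ d) (λ ()))

  linearForm-*P : ∀ {m} {L : Poly m} → LinearForm L → ∀ A e →
                  (L *P A) e ≈ ∑[ j < m ] (L (unitMon j) * varMul j A e)
  linearForm-*P L-lin A [] = trans (+-identityʳ _) (trans (*-congʳ (L-lin [] (λ ()))) (zeroˡ _))
  linearForm-*P {L = L} L-lin A (k ∷ e) =
    trans (*P-∷ L A k e)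
          (trans (+-cong (linearForm-*P (L-lin ∘ (0 ∷_)) (A ∘ (k ∷_)) e) (linearForm-*P-head L-lin A k e))
                 (+-comm _ _))

  linearForm-*P-cong : ∀ {m} {L : Poly m} → LinearForm L → ∀ {A B} e →
    (∀ j t → lookup e j ≡ suc t → A (e [ j ]≔ t) ≈ B (e [ j ]≔ t)) → (L *P A) e ≈ (L *P B) e
  linearForm-*P-cong L-lin {A} {B} e A≈B =
    trans (linearForm-*P L-lin A e)
          (trans (sum-cong-≋ (λ j → *-congˡ (atPred-cong (lookup e j) (A≈B j))))
                 (sym (linearForm-*P L-lin B e)))

  varMul-linearForm-*P : ∀ {m} {L : Poly m} → LinearForm L → ∀ j B e →
    varMul j (L *P B) e ≈ ∑[ k < m ] (L (unitMon k) * varMul j (varMul k B) e)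
  varMul-linearForm-*P {m} {L} L-lin j B e = begin
    varMul j (L *P B) e
      ≈⟨ atPred-cong (lookup e j) (λ t _ → linearForm-*P L-lin B (e [ j ]≔ t)) ⟩
    atPred (lookup e j) (λ t → ∑[ k < m ] (L (unitMon k) * varMul k B (e [ j ]≔ t)))
      ≈⟨ atPred-∑ (lookup e j) (λ t k → L (unitMon k) * varMul k B (e [ j ]≔ t)) ⟩
    ∑[ k < m ] atPred (lookup e j) (λ t → L (unitMon k) * varMul k B (e [ j ]≔ t))
      ≈⟨ sum-cong-≋ (λ k → atPred-* (lookup e j) (L (unitMon k)) _) ⟩
    ∑[ k < m ] (L (unitMon k) * varMul j (varMul k B) e)
      ∎

  linearForm²-*P≈0 : Char2 F → ∀ {m} {L : Poly m} → LinearForm L →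
                     ∀ B e → MultilinearMon e → (L *P (L *P B)) e ≈ 0#
  linearForm²-*P≈0 char2 {m} {L} L-lin B e e-ml = begin
    (L *P (L *P B)) e
      ≈⟨ linearForm-*P L-lin _ e ⟩
    ∑[ j < m ] (α j * varMul j (L *P B) e)
      ≈⟨ sum-cong-≋ (λ j → trans (*-congˡ (varMul-linearForm-*P L-lin j B e))
                                 (*-distribˡ-sum (α j) (λ k → α k * varMul j (varMul k B) e))) ⟩
    ∑[ j < m ] ∑[ k < m ] G j k
      ≈⟨ ∑∑-symmetric≈ε (x+x≈0 char2) G G-sym G-diag ⟩
    0# ∎
    where
    α : Fin m → Carrier
    α j = L (unitMon j)
    G : Fin m → Fin m → Carrier
    G j k = α j * (α k * varMul j (varMul k B) e)
    G-sym : ∀ j k → G j k ≈ G k j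
    G-sym j k = trans (x∙yz≈y∙xz _ _ _) (*-congˡ (*-congˡ (varMul-comm j k B e)))
    G-diag : ∀ j → G j j ≈ 0#
    G-diag j = trans (*-congˡ (trans (*-congˡ (varMul²≈0 j B e (lookup⁺ e-ml j))) (zeroʳ _))) (zeroʳ _)

  ∂-at-0 : ∀ {m} i (A : Poly m) v → lookup v i ≡ 0 → ∂ i A v ≈ A (v [ i ]≔ 1)
  ∂-at-0 i A v vᵢ≡0 rewrite vᵢ≡0 = +-identityʳ _

  ∂-at-1 : Char2 F → ∀ {m} i (A : Poly m) v → lookup v i ≡ 1 → ∂ i A v ≈ 0#
  ∂-at-1 char2 i A v vᵢ≡1 rewrite vᵢ≡1 = trans (+-congˡ (+-identityʳ _)) (x+x≈0 char2 _)

  varMul-∂ : ∀ {m} {i k : Fin m} → k ≢ i → ∀ (A : Poly m) v → lookup v i ≡ 0 →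
             varMul k A (v [ i ]≔ 1) ≈ varMul k (∂ i A) v
  varMul-∂ {i = i} {k} k≢i A v vᵢ≡0 = begin
    varMul k A (v [ i ]≔ 1)                                 ≡⟨ varMul-update′ (k≢i ∘ ≡.sym) A v 1 ⟩
    atPred (lookup v k) (λ t → A ((v [ i ]≔ 1) [ k ]≔ t))  ≈⟨ atPred-cong (lookup v k) (λ t _ → shifted t) ⟩
    varMul k (∂ i A) v                                      ∎
    where
    shifted : ∀ t → A ((v [ i ]≔ 1) [ k ]≔ t) ≈ ∂ i A (v [ k ]≔ t)
    shifted t = sym (trans (∂-at-0 i A (v [ k ]≔ t) (≡.trans (lookup∘update′ (k≢i ∘ ≡.sym) v t) vᵢ≡0))
                           (reflexive (≡.cong A ([]≔-commutes v k i k≢i))))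

  -- The Leibniz rule ∂ᵢ(L·A) = αᵢ A + L·∂ᵢA, read off at x^v with vᵢ = 0.
  linearForm-*P-∂ : ∀ {m} {L : Poly m} → LinearForm L → ∀ (A : Poly m) i v → lookup v i ≡ 0 →
                    (L *P A) (v [ i ]≔ 1) ≈ L (unitMon i) * A v + (L *P ∂ i A) v
  linearForm-*P-∂ {m} {L} L-lin A i v vᵢ≡0 = begin
    (L *P A) (v [ i ]≔ 1)
      ≈⟨ linearForm-*P L-lin A (v [ i ]≔ 1) ⟩
    ∑[ k < m ] (L (unitMon k) * varMul k A (v [ i ]≔ 1))
      ≈⟨ sum-extract _ _ i (trans (*-congˡ (reflexive (varMul-at-zero i (∂ i A) v vᵢ≡0))) (zeroʳ _))
                           (λ k k≢i → *-congˡ (varMul-∂ k≢i A v vᵢ≡0)) ⟩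
    L (unitMon i) * varMul i A (v [ i ]≔ 1) + ∑[ k < m ] (L (unitMon k) * varMul k (∂ i A) v)
      ≈⟨ +-cong (*-congˡ (reflexive (≡.sym xᵢ-removed))) (linearForm-*P L-lin (∂ i A) v) ⟨
    L (unitMon i) * A v + (L *P ∂ i A) v
      ∎
    where
    xᵢ-removed : varMul i A (v [ i ]≔ 1) ≡ A v
    xᵢ-removed = ≡.trans (varMul-at-suc i A (v [ i ]≔ 1) (lookup∘update i v 1))
                         (≡.cong A ([]≔-restore v i vᵢ≡0))

  module Reconstruction (char2 : Char2 F) {m} {L : Poly m} (L-lin : LinearForm L) (P : Poly m)
                        {i : Fin m} {αinv : Carrier} (α*αinv≈1 : L (unitMon i) * αinv ≈ 1#) where

    α-cancel : ∀ x → L (unitMon i) * (αinv * x) ≈ x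
    α-cancel x = trans (sym (*-assoc _ _ _)) (trans (*-congʳ α*αinv≈1) (*-identityˡ x))

    reconstruct-at-i≡1 : ∀ e → lookup e i ≡ 1 → (L *P (αinv ·P ∂ i P)) e ≈ P e
    reconstruct-at-i≡1 e eᵢ≡1 = begin
      (L *P D) e
        ≈⟨ linearForm-*P L-lin D e ⟩
      ∑[ j < m ] (L (unitMon j) * varMul j D e)
        ≈⟨ sum-single _ i (λ j j≢i → trans (*-congˡ (others≈0 j j≢i)) (zeroʳ _)) ⟩
      L (unitMon i) * varMul i D e
        ≡⟨ ≡.cong (L (unitMon i) *_) (varMul-at-suc i D e eᵢ≡1) ⟩
      L (unitMon i) * (αinv * ∂ i P (e [ i ]≔ 0))
        ≈⟨ *-congˡ (*-congˡ (∂-at-0 i P _ (lookup∘update i e 0))) ⟩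
      L (unitMon i) * (αinv * P ((e [ i ]≔ 0) [ i ]≔ 1))
        ≡⟨ ≡.cong (λ v → L (unitMon i) * (αinv * P v)) ([]≔-restore e i eᵢ≡1) ⟩
      L (unitMon i) * (αinv * P e)
        ≈⟨ α-cancel (P e) ⟩
      P e
        ∎
      where
      D : Poly m
      D = αinv ·P ∂ i P
      others≈0 : ∀ j → j ≢ i → varMul j D e ≈ 0#
      others≈0 j j≢i = atPred-≈0 (lookup e j) (λ t _ →
        trans (*-congˡ (∂-at-1 char2 i P _ (≡.trans (lookup∘update′ (j≢i ∘ ≡.sym) e t) eᵢ≡1))) (zeroʳ αinv))

    module _ {Q : Poly m} (P≈LQ : P ≈P Mult₀ (L *P Q)) where

      P≈*P : ∀ v → MultilinearMon v → P v ≈ (L *P Q) v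
      P≈*P v v-ml = trans (P≈LQ v) (Mult₀-multilinear _ v v-ml)

      αinv∂P≈ : ∀ v → MultilinearMon v → lookup v i ≡ 0 →
                (αinv ·P ∂ i P) v ≈ (Q +P αinv ·P (L *P ∂ i Q)) v
      αinv∂P≈ v v-ml vᵢ≡0 = begin
        αinv * ∂ i P v
          ≈⟨ *-congˡ (∂-at-0 i P v vᵢ≡0) ⟩
        αinv * P (v [ i ]≔ 1)
          ≈⟨ *-congˡ (P≈*P _ (All≤1-update v-ml i (s≤s z≤n))) ⟩
        αinv * (L *P Q) (v [ i ]≔ 1)
          ≈⟨ *-congˡ (linearForm-*P-∂ L-lin Q i v vᵢ≡0) ⟩
        αinv * (L (unitMon i) * Q v + (L *P ∂ i Q) v)
          ≈⟨ distribˡ _ _ _ ⟩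
        αinv * (L (unitMon i) * Q v) + αinv * (L *P ∂ i Q) v
          ≈⟨ +-congʳ (trans (x∙yz≈y∙xz _ _ _) (α-cancel _)) ⟩
        Q v + αinv * (L *P ∂ i Q) v
          ∎

      reconstruct-at-i≡0 : ∀ e → MultilinearMon e → lookup e i ≡ 0 → (L *P (αinv ·P ∂ i P)) e ≈ P e
      reconstruct-at-i≡0 e e-ml eᵢ≡0 = begin
        (L *P (αinv ·P ∂ i P)) e
          ≈⟨ linearForm-*P-cong L-lin e lowered ⟩
        (L *P (Q +P αinv ·P (L *P ∂ i Q))) e
          ≈⟨ *P-distribˡ-+P L Q _ e ⟩
        (L *P Q) e + (L *P (αinv ·P (L *P ∂ i Q))) e
          ≈⟨ +-cong (sym (P≈*P e e-ml)) (*P-·P L _ αinv e) ⟩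
        P e + αinv * (L *P (L *P ∂ i Q)) e
          ≈⟨ +-congˡ (trans (*-congˡ (linearForm²-*P≈0 char2 L-lin (∂ i Q) e e-ml)) (zeroʳ αinv)) ⟩
        P e + 0#
          ≈⟨ +-identityʳ (P e) ⟩
        P e
          ∎
        where
        lowered : ∀ j t → lookup e j ≡ suc t →
                  (αinv ·P ∂ i P) (e [ j ]≔ t) ≈ (Q +P αinv ·P (L *P ∂ i Q)) (e [ j ]≔ t)
        lowered j t eⱼ≡1+t = αinv∂P≈ _ (All≤1-update e-ml j t≤1) lowered-at-i
          where
          t≤1 : t ≤ 1
          t≤1 = ≤-trans (n≤1+n t) (≡.subst (_≤ 1) eⱼ≡1+t (lookup⁺ e-ml j))
          lowered-at-i : lookup (e [ j ]≔ t) i ≡ 0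
          lowered-at-i with i ≟ j
          ... | yes i≡j = ⊥-elim (0≢1+n (≡.trans (≡.sym eᵢ≡0) (≡.trans (≡.cong (lookup e) i≡j) eⱼ≡1+t)))
          ... | no i≢j  = ≡.trans (lookup∘update′ i≢j e t) eᵢ≡0

      reconstruct : Multilinear P → P ≈P Mult₀ (L *P (αinv ·P ∂ i P))
      reconstruct P-ml e with all? (_≤? 1) e
      ... | no ¬e-ml = P-ml e ¬e-ml
      ... | yes e-ml with n≤1⇒n≡0∨n≡1 (lookup⁺ e-ml i)
      ...   | inj₁ eᵢ≡0 = sym (reconstruct-at-i≡0 e e-ml eᵢ≡0)
      ...   | inj₂ eᵢ≡1 = sym (reconstruct-at-i≡1 e eᵢ≡1)

lemma5p3 : ∀ {c ℓ} (F : CommutativeRing c ℓ) → IsFiniteField F → Char2 F →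
    let open CommutativeRing F
        open PolyDefs F
    in (m : ℕ) (P L : Poly m) (i : Fin m) →
       Multilinear P →
       TotalDeg≤1 L → L (zeroMon m) ≈ 0# → ¬ (L (unitMon i) ≈ 0#) →
       Σ (Poly m) (λ Q → Multilinear Q × (P ≈P Mult₀ (L *P Q))) →
       (αinv : Carrier) → L (unitMon i) * αinv ≈ 1# →
       P ≈P Mult₀ (L *P (αinv ·P ∂ i P))
lemma5p3 F _ char2 m P L i P-ml deg≤1 L₀≈0 _ (_ , _ , P≈LQ) αinv α*αinv≈1 =
  Reconstruction.reconstruct char2 (totalDeg≤1⇒LinearForm deg≤1 L₀≈0) P α*αinv≈1 P≈LQ P-ml
  where open Coefficients F
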